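{- Let $G$ be a $2$-regular graph and let $H$ be a graph with $n=|V(H)|$ vertices. Then \[\chi_G(H)+\chi_G(\overline{H})\leq \left\lceil \frac{n}{2}\right\rceil+1,\] and this bound is sharp, i.e., there exist such graphs $H,G$ for which equality holds.
   Context: All graphs are finite and simple. A copy of $G$ in $H$ is a subgraph of $H$ isomorphic to $G$. A $G$-free $k$-coloring of $H$ is a map $\pi:V(H)\to\{1,\dots,k\}$ such that each induced subgraph $H[\pi^{ -1}(i)]$ contains no copy of $G$; $\chi_G(H)$ is the least $k$ for which such a coloring exists. $\overline{H}$ is the complement of $H$. -}

module Defs where

open import Data.Nat using (ℕ; _≤_; _+_; _<_)
open import Data.Fin using (Fin; _≟_)
open import Data.Bool using (Bool; true; false; not; if_then_else_)
open import Data.List using (List; length; filter)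
open import Data.List using () renaming (map to lmap)
open import Data.Fin.Base using ()
open import Data.List.Base using (allFin)
open import Data.Product using (Σ; _×_; _,_)
open import Relation.Nullary using (¬_; does)
open import Relation.Binary.PropositionalEquality using (_≡_; refl; sym; cong)
open import Function.Definitions using (Injective)

record Graph (n : ℕ) : Set where
  field
    adj    : Fin n → Fin n → Bool
    adj-sym : ∀ i j → adj i j ≡ adj j i
    adj-irr : ∀ i → adj i i ≡ false
open Graph public

complement : ∀ {n} → Graph n → Graph n
complement {n} H = record { adj = a ; adj-sym = s ; adj-irr = r }
  where
  a : Fin n → Fin n → Bool
  a i j = if does (i ≟ j) then false else not (adj H i j)
  s : ∀ i j → a i j ≡ a j i
  s i j with i ≟ j | j ≟ i
  ... | Relation.Nullary.yes _ | Relation.Nullary.yes _ = refl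
  ... | Relation.Nullary.yes p | Relation.Nullary.no q = Data.Empty.⊥-elim (q (sym p))
    where import Data.Empty
  ... | Relation.Nullary.no p | Relation.Nullary.yes q = Data.Empty.⊥-elim (p (sym q))
    where import Data.Empty
  ... | Relation.Nullary.no _ | Relation.Nullary.no _ = cong not (adj-sym H i j)
  r : ∀ i → a i i ≡ false
  r i with i ≟ i
  ... | Relation.Nullary.yes _ = refl
  ... | Relation.Nullary.no p = Data.Empty.⊥-elim (p refl)
    where import Data.Empty

degree : ∀ {m} → Graph m → Fin m → ℕ
degree {m} G v = length (filter (λ j → adj G v j Data.Bool.≟ true) (allFin m))
  where import Data.Bool

TwoRegular : ∀ {m} → Graph m → Set
TwoRegular {m} G = (0 < m) × (∀ v → degree G v ≡ 2)

-- A copy of G in H whose vertices all lie in the vertex set P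
-- (i.e. a copy of G in the induced subgraph H[P]): an injective map
-- V(G) → V(H) landing in P and sending edges to edges.
CopyIn : ∀ {m n} → Graph m → Graph n → (Fin n → Set) → Set
CopyIn {m} {n} G H P =
  Σ (Fin m → Fin n) λ f →
    Injective _≡_ _≡_ f ×
    (∀ v → P (f v)) ×
    (∀ u v → adj G u v ≡ true → adj H (f u) (f v) ≡ true)

GFreeColoring : ∀ {m n} → Graph m → Graph n → (k : ℕ) → (Fin n → Fin k) → Set
GFreeColoring G H k π = ∀ (c : Fin _) → ¬ CopyIn G H (λ x → π x ≡ c)

GFreeColorable : ∀ {m n} → Graph m → Graph n → ℕ → Set
GFreeColorable {n = n} G H k = Σ (Fin n → Fin k) λ π → GFreeColoring G H k π

IsChiG : ∀ {m n} → Graph m → Graph n → ℕ → Set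
IsChiG G H k = GFreeColorable G H k × (∀ k' → GFreeColorable G H k' → k ≤ k')

{-# OPTIONS --safe #-}
-- A colouring in which, along some vertex order, no vertex has two earlier
-- neighbours of its own colour is G-free for every 2-regular G: the last vertex of
-- a monochromatic copy of G would have two earlier neighbours in the copy.  Such
-- colourings of H and of its complement, with a₁ and a₂ colours and a common vertex
-- order, are built on a growing vertex set S while keeping 2(a₁ + a₂) ≤ |S| + 3,
-- adding two vertices u, v at a time.  A vertex that cannot reuse any colour of one
-- colouring has at least two neighbours of each colour there, hence at least 2a
-- neighbours; its degrees in H and in the complement sum to the number of vertices
-- already placed.  Choosing u, v with H-degrees differing by at most one (possible
-- by pigeonhole, as degrees are smaller than |S|), this shows that when the bound
-- is nearly tight the pair costs at most one new colour; otherwise u and v share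
-- two fresh colours.  For S = V(H) this gives χ_G(H) + χ_G(H̄) ≤ a₁ + a₂ ≤
-- ⌊(n + 3)/2⌋ = ⌈n/2⌉ + 1, with equality for the triangle and a single vertex.

module Submission where

open import Defs
open import Data.Nat using (ℕ; zero; suc; _+_; _*_; _≤_; _<_; z≤n; s≤s; ⌈_/2⌉; ⌊_/2⌋; _<ᵇ_; _≡ᵇ_)
open import Data.Nat.Properties hiding (_≟_)
open import Data.Fin using (Fin; zero; suc; toℕ; fromℕ<; _≟_)
open import Data.Fin.Properties using (any?; all?; toℕ<n; toℕ-fromℕ<; pigeonhole)
  renaming (suc-injective to fsuc-injective)
open import Data.Bool using (Bool; true; false; not; _∧_; _∨_; if_then_else_; T)
open import Data.Bool.Properties
  using (T-≡; ∧-zeroʳ; ∨-identityʳ; ∧-identityʳ; not-involutive; ∨-assoc; ∨-comm) renaming (_≟_ to _≟ᵇ_)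
open import Data.Product using (Σ; _×_; _,_; proj₁; proj₂; ∃)
open import Data.Sum using (_⊎_; inj₁; inj₂; [_,_]′)
open import Data.Maybe using (Maybe; just; nothing)
open import Data.Empty using (⊥; ⊥-elim)
open import Data.List using (length; filter; tabulate; allFin)
open import Data.List.Extrema.Nat using (argmax; f[xs]≤f[argmax])
open import Data.List.Membership.Propositional.Properties using (∈-allFin)
open import Data.List.Relation.Unary.All using (lookup)
open import Data.Vec.Functional using (_∷_; head; tail)
open import Function using (_∘_)
open import Function.Bundles using (Equivalence)
open import Function.Definitions using (Injective)
open import Relation.Nullary using (¬_; Dec; yes; no; does)
open import Relation.Nullary.Decidable using (_×-dec_; _→-dec_; ¬?; map′; dec-true; dec-false)
open import Relation.Binary.PropositionalEquality

private
  variable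
    N : ℕ

∧-true : {a b : Bool} → (a ∧ b) ≡ true → a ≡ true × b ≡ true
∧-true {true} {true} _ = refl , refl

∨-false⇒ : {a b : Bool} → (a ∨ b) ≡ true → b ≡ false → a ≡ true
∨-false⇒ {true} _ _ = refl
∨-false⇒ {false} {true} _ ()

≡ᵇ-true⇒≡ : ∀ {m n} → (m ≡ᵇ n) ≡ true → m ≡ n
≡ᵇ-true⇒≡ {m} {n} eq = ≡ᵇ⇒≡ m n (Equivalence.from T-≡ eq)

≡⇒≡ᵇ-true : ∀ {m n} → m ≡ n → (m ≡ᵇ n) ≡ true
≡⇒≡ᵇ-true {m} {n} m≡n = Equivalence.to T-≡ (≡⇒≡ᵇ m n m≡n)

bit : Bool → ℕ
bit true = 1
bit false = 0

_==_ : Fin N → Fin N → Bool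
x == y = does (x ≟ y)

==-refl : (x : Fin N) → (x == x) ≡ true
==-refl x = dec-true (x ≟ x) refl

==⇒≡ : {x y : Fin N} → (x == y) ≡ true → x ≡ y
==⇒≡ {x = x} {y} _ with x ≟ y
... | yes x≡y = x≡y

≢⇒==false : {x y : Fin N} → ¬ x ≡ y → (x == y) ≡ false
≢⇒==false {x = x} {y} = dec-false (x ≟ y)

-- Counting subsets of Fin N

count : (Fin N → Bool) → ℕ
count {zero} p = 0
count {suc N} p = bit (p zero) + count (p ∘ suc)

count-cong : {p q : Fin N → Bool} → p ≗ q → count p ≡ count q
count-cong {zero} _ = refl
count-cong {suc N} p≗q rewrite p≗q zero = cong (_ +_) (count-cong (p≗q ∘ suc))

count-mono : {p q : Fin N → Bool} → (∀ y → p y ≡ true → q y ≡ true) → count p ≤ count q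
count-mono {zero} _ = z≤n
count-mono {suc N} {p} {q} p⊆q with p zero in p₀ | q zero in q₀
... | true  | true  = s≤s (count-mono (p⊆q ∘ suc))
... | false | true  = m≤n⇒m≤1+n (count-mono (p⊆q ∘ suc))
... | false | false = count-mono (p⊆q ∘ suc)
... | true  | false with () ← trans (sym (p⊆q zero p₀)) q₀

count-split : (p q : Fin N → Bool) →
              count p ≡ count (λ y → p y ∧ q y) + count (λ y → p y ∧ not (q y))
count-split {zero} p q = refl
count-split {suc N} p q with p zero | q zero
... | true  | true  = cong suc (count-split (p ∘ suc) (q ∘ suc))
... | true  | false = trans (cong suc (count-split (p ∘ suc) (q ∘ suc))) (sym (+-suc _ _))
... | false | _     = count-split (p ∘ suc) (q ∘ suc)

count-none : {p : Fin N → Bool} → (∀ y → p y ≡ false) → count p ≡ 0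
count-none {zero} _ = refl
count-none {suc N} p∅ rewrite p∅ zero = count-none (p∅ ∘ suc)

count>0⇒∃ : {p : Fin N → Bool} → 0 < count p → ∃ λ y → p y ≡ true
count>0⇒∃ {suc N} {p} pos with p zero in p₀
... | true = zero , p₀
... | false with count>0⇒∃ pos
... | y , py = suc y , py

count≥1 : {p : Fin N → Bool} {x : Fin N} → p x ≡ true → 1 ≤ count p
count≥1 {suc N} {p} {zero} px rewrite px = s≤s z≤n
count≥1 {suc N} {p} {suc x} px = ≤-trans (count≥1 {p = p ∘ suc} px) (m≤n+m _ _)

count≥2 : {p : Fin N → Bool} {x y : Fin N} → ¬ x ≡ y → p x ≡ true → p y ≡ true → 2 ≤ count p
count≥2 {x = zero} {zero} x≢y _ _ = ⊥-elim (x≢y refl)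
count≥2 {p = p} {zero} {suc y} _ px py rewrite px = s≤s (count≥1 {p = p ∘ suc} py)
count≥2 {p = p} {suc x} {zero} _ px py rewrite py = s≤s (count≥1 {p = p ∘ suc} px)
count≥2 {p = p} {suc x} {suc y} x≢y px py =
  ≤-trans (count≥2 {p = p ∘ suc} (x≢y ∘ cong suc) px py) (m≤n+m _ _)

count≥2⇒∃₂ : {p : Fin N → Bool} → 2 ≤ count p →
             ∃ λ x → ∃ λ y → ¬ x ≡ y × p x ≡ true × p y ≡ true
count≥2⇒∃₂ {suc N} {p} two with p zero in p₀
... | true with count>0⇒∃ (≤-pred two)
...   | y , py = zero , suc y , (λ ()) , p₀ , py
count≥2⇒∃₂ {suc N} {p} two | false with count≥2⇒∃₂ two
...   | x , y , x≢y , px , py = suc x , suc y , x≢y ∘ fsuc-injective , px , py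

count≤1 : {p : Fin N → Bool} → (∀ x y → p x ≡ true → p y ≡ true → x ≡ y) → count p ≤ 1
count≤1 {p = p} unique with count p ≤? 1
... | yes ≤1 = ≤1
... | no ≰1 with count≥2⇒∃₂ (≰⇒> ≰1)
...   | x , y , x≢y , px , py = ⊥-elim (x≢y (unique x y px py))

count-all : count (λ (_ : Fin N) → true) ≡ N
count-all {zero} = refl
count-all {suc N} = cong suc count-all

count≡0⇒empty : {S : Fin N → Bool} → count S ≡ 0 → S ≗ λ _ → false
count≡0⇒empty {S = S} none y with S y in Sy
... | false = refl
... | true with () ← ≤-trans (count≥1 {p = S} Sy) (≤-reflexive none)

insert : Fin N → (Fin N → Bool) → Fin N → Bool
insert x W y = W y ∨ (y == x)

insert-∉ : {W : Fin N → Bool} {x y : Fin N} → W y ≡ false → ¬ y ≡ x → insert x W y ≡ false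
insert-∉ {x = x} {y} Wy y≢x rewrite Wy = ≢⇒==false y≢x

insert-comm : {W : Fin N → Bool} (u v y : Fin N) → insert u (insert v W) y ≡ insert v (insert u W) y
insert-comm {W = W} u v y = begin
  (W y ∨ (y == v)) ∨ (y == u)   ≡⟨ ∨-assoc (W y) _ _ ⟩
  W y ∨ ((y == v) ∨ (y == u))   ≡⟨ cong (W y ∨_) (∨-comm (y == v) _) ⟩
  W y ∨ ((y == u) ∨ (y == v))   ≡⟨ ∨-assoc (W y) _ _ ⟨
  (W y ∨ (y == u)) ∨ (y == v)   ∎
  where open ≡-Reasoning

count-∧-insert : {W : Fin N → Bool} (q : Fin N → Bool) {x : Fin N} → W x ≡ false →
                 count (λ y → insert x W y ∧ q y) ≡ bit (q x) + count (λ y → W y ∧ q y)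
count-∧-insert {suc N} {W} q {zero} W₀ rewrite W₀ =
  cong (_ +_) (count-cong λ y → cong (_∧ q (suc y)) (∨-identityʳ (W (suc y))))
count-∧-insert {suc N} {W} q {suc x} Wx
  rewrite ∨-identityʳ (W zero) | count-∧-insert {W = W ∘ suc} (q ∘ suc) Wx
  with W zero ∧ q zero
... | true  = sym (+-suc _ _)
... | false = refl

count-insert : {W : Fin N → Bool} {x : Fin N} → W x ≡ false → count (insert x W) ≡ suc (count W)
count-insert {N} {W} {x} Wx = begin
  count (insert x W)                   ≡⟨ count-cong {N} (λ y → sym (∧-identityʳ _)) ⟩
  count (λ y → insert x W y ∧ true)    ≡⟨ count-∧-insert {W = W} (λ _ → true) Wx ⟩
  suc (count (λ y → W y ∧ true))       ≡⟨ cong suc (count-cong {N} (λ y → ∧-identityʳ _)) ⟩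
  suc (count W)                        ∎
  where open ≡-Reasoning

remove : Fin N → (Fin N → Bool) → Fin N → Bool
remove x S y = S y ∧ not (y == x)

remove-self : (S : Fin N → Bool) (x : Fin N) → remove x S x ≡ false
remove-self S x rewrite ==-refl x = ∧-zeroʳ (S x)

remove-other : {S : Fin N → Bool} {x y : Fin N} → S y ≡ true → ¬ y ≡ x → remove x S y ≡ true
remove-other Sy y≢x rewrite Sy | ≢⇒==false y≢x = refl

insert-remove : {S : Fin N → Bool} {x : Fin N} → S x ≡ true → insert x (remove x S) ≗ S
insert-remove {S = S} {x} Sx y with y == x in y≟x
... | true rewrite ==⇒≡ {x = y} {x} y≟x | Sx = refl
... | false = trans (∨-identityʳ _) (∧-identityʳ (S y))

count-remove : {S : Fin N → Bool} {x : Fin N} → S x ≡ true → count S ≡ suc (count (remove x S))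
count-remove {N} {S} {x} Sx =
  trans (count-cong {N} (sym ∘ insert-remove Sx)) (count-insert {W = remove x S} (remove-self S x))

2*colours≤count : ∀ b (Q : Fin N → Bool) (col : Fin N → ℕ) →
                  (∀ c → c < b → 2 ≤ count (λ y → Q y ∧ (col y ≡ᵇ c))) → 2 * b ≤ count Q
2*colours≤count zero Q col _ = z≤n
2*colours≤count (suc b) Q col twice = begin
  2 * suc b                                    ≡⟨ *-suc 2 b ⟩
  2 + 2 * b                                    ≤⟨ +-mono-≤ (twice b ≤-refl) (2*colours≤count b Q′ col twice′) ⟩
  count (λ y → Q y ∧ (col y ≡ᵇ b)) + count Q′  ≡⟨ count-split Q (λ y → col y ≡ᵇ b) ⟨
  count Q                                      ∎
  where
  open ≤-Reasoning
  Q′ : Fin _ → Bool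
  Q′ y = Q y ∧ not (col y ≡ᵇ b)
  still : ∀ {c} → c < b → ∀ y → (Q y ∧ (col y ≡ᵇ c)) ≡ true → (Q′ y ∧ (col y ≡ᵇ c)) ≡ true
  still {c} c<b y e with Q y | col y ≡ᵇ c in is-c | col y ≡ᵇ b in is-b | e
  ... | true | true | false | _ = refl
  ... | true | true | true  | _ =
    ⊥-elim (<-irrefl (trans (sym (≡ᵇ-true⇒≡ {col y} is-c)) (≡ᵇ-true⇒≡ {col y} is-b)) c<b)
  twice′ : ∀ c → c < b → 2 ≤ count (λ y → Q′ y ∧ (col y ≡ᵇ c))
  twice′ c c<b = ≤-trans (twice c (m<n⇒m<1+n c<b)) (count-mono (still c<b))

Separated : (Fin N → Bool) → (Fin N → ℕ) → Set
Separated S D = ∀ {x y} → S x ≡ true → S y ≡ true → ¬ x ≡ y →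
                D x ≤ suc (D y) → D y ≤ suc (D x) → ⊥

separated-count-≤ : ∀ B {S : Fin N → Bool} {D : Fin N → ℕ} →
                    (∀ {x} → S x ≡ true → D x < B) → Separated S D → 2 * count S ≤ suc B
separated-count-≤ zero {S} bounded _ = ≤-trans (≤-reflexive (cong (2 *_) (count-none S∅))) z≤n
  where
  S∅ : ∀ y → S y ≡ false
  S∅ y with S y in Sy
  ... | false = refl
  ... | true with () ← bounded Sy
separated-count-≤ (suc zero) {S} {D} bounded separated = *-monoʳ-≤ 2 (count≤1 unique)
  where
  unique : ∀ x y → S x ≡ true → S y ≡ true → x ≡ y
  unique x y Sx Sy with x ≟ y
  ... | yes x≡y = x≡y
  ... | no x≢y = ⊥-elim (separated Sx Sy x≢y (≤-trans (≤-pred (bounded Sx)) z≤n)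
                                              (≤-trans (≤-pred (bounded Sy)) z≤n))
separated-count-≤ (suc (suc B)) {S} {D} bounded separated = begin
  2 * count S                   ≡⟨ cong (2 *_) (count-split S (λ y → D y <ᵇ B)) ⟩
  2 * (count low + count high)  ≡⟨ *-distribˡ-+ 2 (count low) (count high) ⟩
  2 * count low + 2 * count high
    ≤⟨ +-mono-≤ (separated-count-≤ B low-bounded λ Sx Sy → separated (proj₁ (∧-true Sx)) (proj₁ (∧-true Sy)))
                (*-monoʳ-≤ 2 (count≤1 high-unique)) ⟩
  suc B + 2                     ≡⟨ +-comm (suc B) 2 ⟩
  suc (suc (suc B))             ∎
  where
  open ≤-Reasoning
  low high : Fin _ → Bool
  low y = S y ∧ (D y <ᵇ B)
  high y = S y ∧ not (D y <ᵇ B)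
  low-bounded : ∀ {x} → low x ≡ true → D x < B
  low-bounded {x} lx = <ᵇ⇒< (D x) B (Equivalence.from T-≡ (proj₂ (∧-true lx)))
  high-bounds : ∀ {x} → high x ≡ true → S x ≡ true × B ≤ D x
  high-bounds {x} hx with S x | D x <ᵇ B in lt | hx
  ... | true | false | _ = refl , ≮⇒≥ (λ Dx<B → subst T lt (<⇒<ᵇ Dx<B))
  high-unique : ∀ x y → high x ≡ true → high y ≡ true → x ≡ y
  high-unique x y hx hy with x ≟ y | high-bounds hx | high-bounds hy
  ... | yes x≡y | _ | _ = x≡y
  ... | no x≢y | Sx , B≤Dx | Sy , B≤Dy =
    ⊥-elim (separated Sx Sy x≢y (≤-trans (≤-pred (bounded Sx)) (s≤s B≤Dy))
                                (≤-trans (≤-pred (bounded Sy)) (s≤s B≤Dx)))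

adj-irrefl : (K : Graph N) {x y : Fin N} → x ≡ y → adj K x y ≡ true → ⊥
adj-irrefl K {x} refl xx with () ← trans (sym xx) (adj-irr K x)

degreeIn : Graph N → (Fin N → Bool) → Fin N → ℕ
degreeIn K W x = count (λ y → W y ∧ adj K x y)

degree-cong : (K : Graph N) {W W′ : Fin N → Bool} → W ≗ W′ → (x : Fin N) →
              degreeIn K W x ≡ degreeIn K W′ x
degree-cong K W≗W′ x = count-cong (λ y → cong (_∧ adj K x y) (W≗W′ y))

degree-insert : (K : Graph N) {W : Fin N → Bool} {u : Fin N} → W u ≡ false → (v : Fin N) →
                degreeIn K (insert u W) v ≡ bit (adj K v u) + degreeIn K W v
degree-insert K Wu v = count-∧-insert (adj K v) Wu

degree-insert-≤ : (K : Graph N) {W : Fin N → Bool} {u : Fin N} → W u ≡ false → (v : Fin N) →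
                  degreeIn K (insert u W) v ≤ suc (degreeIn K W v)
degree-insert-≤ K {u = u} Wu v = subst (_≤ _) (sym (degree-insert K Wu v)) (bit+≤suc (adj K v u))
  where
  bit+≤suc : ∀ b {d} → bit b + d ≤ suc d
  bit+≤suc true  = ≤-refl
  bit+≤suc false = n≤1+n _

degree-remove : (K : Graph N) {S : Fin N → Bool} {w : Fin N} → S w ≡ true → (x : Fin N) →
                degreeIn K S x ≡ bit (adj K x w) + degreeIn K (remove w S) x
degree-remove K {S} {w} Sw x =
  trans (count-cong (λ y → cong (_∧ adj K x y) (sym (insert-remove Sw y))))
        (degree-insert K (remove-self S w) x)

degree<count : (K : Graph N) {S : Fin N → Bool} {x : Fin N} → S x ≡ true → degreeIn K S x < count S
degree<count K {S} {x} Sx = begin-strict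
  degreeIn K S x            ≤⟨ count-mono neighbour-remains ⟩
  count (remove x S)        <⟨ n<1+n _ ⟩
  suc (count (remove x S))  ≡⟨ count-remove {S = S} Sx ⟨
  count S                   ∎
  where
  open ≤-Reasoning
  neighbour-remains : ∀ y → (S y ∧ adj K x y) ≡ true → remove x S y ≡ true
  neighbour-remains y Sxy with ∧-true {S y} Sxy
  ... | Sy , xy = remove-other {S = S} Sy λ y≡x → adj-irrefl K (sym y≡x) xy

Complementary : Graph N → Graph N → Set
Complementary K₁ K₂ = ∀ {x y} → ¬ x ≡ y → adj K₂ x y ≡ not (adj K₁ x y)

complement-complementary : (H : Graph N) → Complementary H (complement H)
complement-complementary H {x} {y} x≢y with x ≟ y
... | yes x≡y = ⊥-elim (x≢y x≡y)
... | no _ = refl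

complementary-sym : {K₁ K₂ : Graph N} → Complementary K₁ K₂ → Complementary K₂ K₁
complementary-sym {K₁ = K₁} {K₂} c {x} {y} x≢y rewrite c x≢y = sym (not-involutive (adj K₁ x y))

degree+degree : {K₁ K₂ : Graph N} → Complementary K₁ K₂ → (W : Fin N → Bool) {x : Fin N} → W x ≡ false →
                degreeIn K₁ W x + degreeIn K₂ W x ≡ count W
degree+degree {K₁ = K₁} {K₂} c W {x} Wx =
  sym (trans (count-split W (adj K₁ x)) (cong (degreeIn K₁ W x +_) (count-cong non-adj)))
  where
  non-adj : ∀ y → (W y ∧ not (adj K₁ x y)) ≡ (W y ∧ adj K₂ x y)
  non-adj y with x ≟ y
  ... | yes refl rewrite Wx = refl
  ... | no x≢y = cong (W y ∧_) (sym (c x≢y))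

Balanced : Graph N → (Fin N → Bool) → Fin N → Fin N → Set
Balanced K W u v = degreeIn K W u ≤ suc (degreeIn K W v) × degreeIn K W v ≤ suc (degreeIn K W u)

balanced-cong : (K : Graph N) {W W′ : Fin N → Bool} → W ≗ W′ → {u v : Fin N} →
                Balanced K W u v → Balanced K W′ u v
balanced-cong K W≗W′ {u} {v} (u≲v , v≲u) =
  subst₂ (λ du dv → du ≤ suc dv) (degree-cong K W≗W′ u) (degree-cong K W≗W′ v) u≲v ,
  subst₂ (λ dv du → dv ≤ suc du) (degree-cong K W≗W′ v) (degree-cong K W≗W′ u) v≲u

balanced-remove-pair : (K : Graph N) {S : Fin N → Bool} {u v : Fin N} → S u ≡ true → S v ≡ true → ¬ u ≡ v →
                       Balanced K S u v → Balanced K (remove u (remove v S)) u v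
balanced-remove-pair K {S} {u} {v} Su Sv u≢v (u≲v , v≲u) =
  cancel (subst₂ (λ du dv → du ≤ suc dv) degree-u degree-v u≲v) ,
  cancel (subst₂ (λ dv du → dv ≤ suc du) degree-v degree-u v≲u)
  where
  open ≡-Reasoning
  S′ = remove u (remove v S)
  B = bit (adj K u v)
  Su′ : remove v S u ≡ true
  Su′ = remove-other {S = S} Su u≢v
  cancel : ∀ {a b} → B + a ≤ suc (B + b) → a ≤ suc b
  cancel {a} {b} le = +-cancelˡ-≤ B a (suc b) (≤-trans le (≤-reflexive (sym (+-suc B b))))
  degree-u : degreeIn K S u ≡ B + degreeIn K S′ u
  degree-u = begin
    degreeIn K S u                                 ≡⟨ degree-remove K {S} Sv u ⟩
    B + degreeIn K (remove v S) u                  ≡⟨ cong (B +_) (degree-remove K {remove v S} Su′ u) ⟩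
    B + (bit (adj K u u) + degreeIn K S′ u)
      ≡⟨ cong (λ b → B + (bit b + degreeIn K S′ u)) (adj-irr K u) ⟩
    B + degreeIn K S′ u                            ∎
  degree-v : degreeIn K S v ≡ B + degreeIn K S′ v
  degree-v = begin
    degreeIn K S v                                 ≡⟨ degree-remove K {S} Sv v ⟩
    bit (adj K v v) + degreeIn K (remove v S) v
      ≡⟨ cong (λ b → bit b + degreeIn K (remove v S) v) (adj-irr K v) ⟩
    degreeIn K (remove v S) v                      ≡⟨ degree-remove K {remove v S} Su′ v ⟩
    bit (adj K v u) + degreeIn K S′ v
      ≡⟨ cong (λ b → bit b + degreeIn K S′ v) (adj-sym K v u) ⟩
    B + degreeIn K S′ v                            ∎

suc<2* : ∀ {c} → 2 ≤ c → suc c < 2 * c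
suc<2* {c} two = ≤-trans (+-monoˡ-≤ c two) (≤-reflexive (cong (c +_) (sym (+-identityʳ c))))

balanced-pair : (K : Graph N) (S : Fin N → Bool) → 2 ≤ count S →
                ∃ λ u → ∃ λ v → S u ≡ true × S v ≡ true × ¬ u ≡ v × Balanced K S u v
balanced-pair K S two
  with any? (λ u → any? λ v → (S u ≟ᵇ true) ×-dec (S v ≟ᵇ true) ×-dec ¬? (u ≟ v) ×-dec
                               (degreeIn K S u ≤? suc (degreeIn K S v)) ×-dec
                               (degreeIn K S v ≤? suc (degreeIn K S u)))
... | yes pair = pair
... | no none = ⊥-elim (<⇒≱ (suc<2* two) (separated-count-≤ (count S) (degree<count K) separated))
  where
  separated : Separated S (degreeIn K S)
  separated {u} {v} Su Sv u≢v u≲v v≲u = none (u , v , Su , Sv , u≢v , u≲v , v≲u)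

-- Forest colourings along a vertex order

record Ranking (W : Fin N → Bool) : Set where
  field
    rank           : Fin N → ℕ
    next           : ℕ
    rank<next      : ∀ {y} → W y ≡ true → rank y < next
    rank-injective : ∀ {y z} → W y ≡ true → W z ≡ true → rank y ≡ rank z → y ≡ z
open Ranking

placeLast : {W : Fin N → Bool} (x : Fin N) → Ranking W → Ranking (insert x W)
placeLast {W = W} x R = record
  { rank = rank′
  ; next = suc (next R)
  ; rank<next = bounded
  ; rank-injective = injective
  }
  where
  rank′ : Fin _ → ℕ
  rank′ y = if y == x then next R else rank R y
  bounded : ∀ {y} → insert x W y ≡ true → rank′ y < suc (next R)
  bounded {y} w with y == x
  ... | true  = n<1+n _
  ... | false = m<n⇒m<1+n (rank<next R (∨-false⇒ w refl))
  injective : ∀ {y z} → insert x W y ≡ true → insert x W z ≡ true → rank′ y ≡ rank′ z → y ≡ z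
  injective {y} {z} wy wz eq with y == x in y≟x | z == x in z≟x
  ... | true  | true  = trans (==⇒≡ y≟x) (sym (==⇒≡ z≟x))
  ... | true  | false = ⊥-elim (<-irrefl (sym eq) (rank<next R (∨-false⇒ wz refl)))
  ... | false | true  = ⊥-elim (<-irrefl eq (rank<next R (∨-false⇒ wy refl)))
  ... | false | false = rank-injective R (∨-false⇒ wy refl) (∨-false⇒ wz refl) eq

-- The colour classes of W are forests: orienting each edge towards the endpoint of
-- higher rank, every vertex has at most one in-neighbour of its own colour.
record ForestColouring (K : Graph N) (W : Fin N → Bool) (rank : Fin N → ℕ) : Set where
  field
    colour             : Fin N → ℕ
    colours            : ℕ
    colour<colours     : ∀ {x} → W x ≡ true → colour x < colours
    no-two-lower-mates : ∀ {x y z} → W x ≡ true → W y ≡ true → W z ≡ true → ¬ y ≡ z →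
                         adj K x y ≡ true → adj K x z ≡ true →
                         colour y ≡ colour x → colour z ≡ colour x →
                         rank y < rank x → rank z < rank x → ⊥
open ForestColouring

module _ {K : Graph N} {W : Fin N → Bool} {rank : Fin N → ℕ} (F : ForestColouring K W rank) where

  mates : Fin N → ℕ → ℕ
  mates x c = count (λ y → (W y ∧ adj K x y) ∧ (colour F y ≡ᵇ c))

  Fits : Fin N → Set
  Fits x = Σ ℕ λ c → c < colours F × mates x c ≤ 1

  Fails : Fin N → Set
  Fails x = ∀ c → c < colours F → 2 ≤ mates x c

  fits-or-fails : (x : Fin N) → Fits x ⊎ Fails x
  fits-or-fails x with any? (λ (c : Fin (colours F)) → mates x (toℕ c) ≤? 1)
  ... | yes (c , few) = inj₁ (toℕ c , toℕ<n c , few)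
  ... | no none = inj₂ λ c c< → ≰⇒> λ few →
    none (fromℕ< c< , subst (λ c → mates x c ≤ 1) (sym (toℕ-fromℕ< c<)) few)

  fails⇒2*colours≤degree : {x : Fin N} → Fails x → 2 * colours F ≤ degreeIn K W x
  fails⇒2*colours≤degree {x} = 2*colours≤count (colours F) (λ y → W y ∧ adj K x y) (colour F)

  fresh-mates : (x : Fin N) → mates x (colours F) ≡ 0
  fresh-mates x = count-none unused
    where
    unused : ∀ y → ((W y ∧ adj K x y) ∧ (colour F y ≡ᵇ colours F)) ≡ false
    unused y with W y in Wy | colour F y ≡ᵇ colours F in is-fresh
    ... | false | _     = refl
    ... | true  | false = ∧-zeroʳ _
    ... | true  | true  = ⊥-elim (<-irrefl (≡ᵇ-true⇒≡ {colour F y} is-fresh) (colour<colours F Wy))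

module _ {K : Graph N} {W : Fin N → Bool} (R : Ranking W) (F : ForestColouring K W (rank R)) where

  colourLast : (x : Fin N) (d c : ℕ) → d < c → colours F ≤ c → mates F x d ≤ 1 →
               ForestColouring K (insert x W) (rank (placeLast x R))
  colourLast x d c d<c colours≤c few = record
    { colour = colour′
    ; colours = c
    ; colour<colours = bounded
    ; no-two-lower-mates = sparse
    }
    where
    colour′ : Fin _ → ℕ
    colour′ y = if y == x then d else colour F y
    rank′ : Fin _ → ℕ
    rank′ = rank (placeLast x R)
    bounded : ∀ {y} → insert x W y ≡ true → colour′ y < c
    bounded {y} w with y == x
    ... | true  = d<c
    ... | false = <-≤-trans (colour<colours F (∨-false⇒ w refl)) colours≤c
    mate : ∀ {y} → W y ≡ true → adj K x y ≡ true → colour F y ≡ d →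
           ((W y ∧ adj K x y) ∧ (colour F y ≡ᵇ d)) ≡ true
    mate Wy xy cy rewrite Wy | xy | ≡⇒≡ᵇ-true cy = refl
    sparse : ∀ {x₀ y z} → insert x W x₀ ≡ true → insert x W y ≡ true → insert x W z ≡ true →
             ¬ y ≡ z → adj K x₀ y ≡ true → adj K x₀ z ≡ true →
             colour′ y ≡ colour′ x₀ → colour′ z ≡ colour′ x₀ →
             rank′ y < rank′ x₀ → rank′ z < rank′ x₀ → ⊥
    sparse {x₀} {y} {z} w₀ wy wz y≢z x₀y x₀z cy cz ry rz
      with x₀ == x in x₀≟x | y == x in y≟x | z == x in z≟x
    ... | true  | true  | _     = adj-irrefl K (trans (==⇒≡ x₀≟x) (sym (==⇒≡ y≟x))) x₀y
    ... | true  | _     | true  = adj-irrefl K (trans (==⇒≡ x₀≟x) (sym (==⇒≡ z≟x))) x₀z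
    ... | false | true  | _     = <-asym ry (rank<next R (∨-false⇒ w₀ refl))
    ... | false | _     | true  = <-asym rz (rank<next R (∨-false⇒ w₀ refl))
    ... | true  | false | false with refl ← ==⇒≡ {x = x₀} {x} x₀≟x =
      <⇒≱ (≤-trans (count≥2 y≢z (mate (∨-false⇒ wy refl) x₀y cy) (mate (∨-false⇒ wz refl) x₀z cz)) few)
          ≤-refl
    ... | false | false | false =
      no-two-lower-mates F (∨-false⇒ w₀ refl) (∨-false⇒ wy refl) (∨-false⇒ wz refl)
                           y≢z x₀y x₀z cy cz ry rz

  extend : (x : Fin N) → Maybe (Fits F x) → ForestColouring K (insert x W) (rank (placeLast x R))
  extend x (just (c , c<colours , few)) = colourLast x c (colours F) c<colours ≤-refl few
  extend x nothing =
    colourLast x (colours F) (suc (colours F)) (n<1+n _) (n≤1+n _)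
               (≤-trans (≤-reflexive (fresh-mates F x)) z≤n)

  fresh-colour-mates : (u v : Fin N) → mates (extend u nothing) v (colours F) ≤ 1
  fresh-colour-mates u v = count≤1 λ y z my mz → trans (only-u y my) (sym (only-u z mz))
    where
    only-u : ∀ y → ((insert u W y ∧ adj K v y) ∧
                    ((if y == u then colours F else colour F y) ≡ᵇ colours F)) ≡ true → y ≡ u
    only-u y m with y == u in y≟u
    ... | true = ==⇒≡ {x = y} {u} y≟u
    ... | false with W y in Wy | adj K v y | colour F y ≡ᵇ colours F in is-fresh | m
    ... | true | true | true | _ =
      ⊥-elim (<-irrefl (≡ᵇ-true⇒≡ {colour F y} is-fresh) (colour<colours F Wy))

-- Colouring two complementary graphs at once

record DoubleColouring (K₁ K₂ : Graph N) (W : Fin N → Bool) : Set where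
  field
    ranking : Ranking W
    forest₁ : ForestColouring K₁ W (rank ranking)
    forest₂ : ForestColouring K₂ W (rank ranking)
open DoubleColouring

module _ {K₁ K₂ : Graph N} where

  total : {W : Fin N → Bool} → DoubleColouring K₁ K₂ W → ℕ
  total D = colours (forest₁ D) + colours (forest₂ D)

  extend₂ : {W : Fin N → Bool} (D : DoubleColouring K₁ K₂ W) (x : Fin N) →
            Maybe (Fits (forest₁ D) x) → Maybe (Fits (forest₂ D) x) →
            DoubleColouring K₁ K₂ (insert x W)
  extend₂ D x fit₁ fit₂ = record
    { ranking = placeLast x (ranking D)
    ; forest₁ = extend (ranking D) (forest₁ D) x fit₁
    ; forest₂ = extend (ranking D) (forest₂ D) x fit₂
    }

  swap : {W : Fin N → Bool} → DoubleColouring K₁ K₂ W → DoubleColouring K₂ K₁ W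
  swap D = record { ranking = ranking D ; forest₁ = forest₂ D ; forest₂ = forest₁ D }

  Cheap : {W : Fin N → Bool} → DoubleColouring K₁ K₂ W → (Fin N → Bool) → Set
  Cheap D W′ = Σ (DoubleColouring K₁ K₂ W′) λ D′ → total D′ ≤ suc (total D)

  Cheap≗ : {W : Fin N → Bool} → DoubleColouring K₁ K₂ W → (Fin N → Bool) → Set
  Cheap≗ D W′ = Σ (Fin N → Bool) λ W″ → W″ ≗ W′ × Cheap D W″

unswap : {K₁ K₂ : Graph N} {W W′ : Fin N → Bool} (D : DoubleColouring K₁ K₂ W) →
         Cheap (swap D) W′ → Cheap D W′
unswap D (D′ , cheap) =
  swap D′ ,
  subst₂ (λ t t′ → t ≤ suc t′) (+-comm (colours (forest₁ D′)) _) (+-comm (colours (forest₂ D)) _) cheap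

2*sum≤ : ∀ {a₁ a₂ d₁ d₂} → 2 * a₁ ≤ d₁ → 2 * a₂ ≤ d₂ → 2 * (a₁ + a₂) ≤ d₁ + d₂
2*sum≤ {a₁} {a₂} le₁ le₂ = ≤-trans (≤-reflexive (*-distribˡ-+ 2 a₁ a₂)) (+-mono-≤ le₁ le₂)

module _ {K₁ K₂ : Graph N} (complementary : Complementary K₁ K₂)
         {W : Fin N → Bool} (D : DoubleColouring K₁ K₂ W) where

  fails-both : {x : Fin N} → W x ≡ false → Fails (forest₁ D) x → Fails (forest₂ D) x →
               2 * total D ≤ count W
  fails-both {x} Wx fails₁ fails₂ =
    ≤-trans (2*sum≤ {colours (forest₁ D)} (fails⇒2*colours≤degree (forest₁ D) fails₁)
                                           (fails⇒2*colours≤degree (forest₂ D) fails₂))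
            (≤-reflexive (degree+degree {K₁ = K₁} {K₂} complementary W {x} Wx))

  extend-cheaply : {y : Fin N} → W y ≡ false → count W < 2 * total D → Cheap D (insert y W)
  extend-cheaply {y} Wy room with fits-or-fails (forest₁ D) y | fits-or-fails (forest₂ D) y
  ... | inj₁ fit₁ | inj₁ fit₂ = extend₂ D y (just fit₁) (just fit₂) , n≤1+n _
  ... | inj₁ fit₁ | inj₂ _    = extend₂ D y (just fit₁) nothing , ≤-reflexive (+-suc _ _)
  ... | inj₂ _    | inj₁ fit₂ = extend₂ D y nothing (just fit₂) , ≤-refl
  ... | inj₂ fails₁ | inj₂ fails₂ = ⊥-elim (<⇒≱ room (fails-both Wy fails₁ fails₂))

module _ {K₁ K₂ : Graph N} (complementary : Complementary K₁ K₂)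
         {W : Fin N → Bool} (D : DoubleColouring K₁ K₂ W) where

  private
    degree-sum : {x : Fin N} → W x ≡ false → degreeIn K₁ W x + degreeIn K₂ W x ≡ count W
    degree-sum {x} = degree+degree {K₁ = K₁} {K₂} complementary W {x}

  extend-fitting : {x y : Fin N} → W x ≡ false → ¬ y ≡ x → W y ≡ false → suc (count W) < 2 * total D →
                   Fits (forest₁ D) x → Fits (forest₂ D) x → Cheap D (insert y (insert x W))
  extend-fitting {x} {y} Wx y≢x Wy crowded fit₁ fit₂ =
    extend-cheaply complementary (extend₂ D x (just fit₁) (just fit₂)) (insert-∉ {W = W} Wy y≢x)
                   (subst (_< 2 * total D) (sym (count-insert {W = W} {x} Wx)) crowded)

  share-fresh : {x y : Fin N} → W x ≡ false → ¬ y ≡ x → W y ≡ false → suc (count W) < 2 * total D →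
                Fits (forest₁ D) x → Fails (forest₂ D) y → Cheap D (insert y (insert x W))
  share-fresh {x} {y} Wx y≢x Wy crowded fit₁ fails₂ = finish (fits-or-fails (forest₁ D₁) y)
    where
    D₁ : DoubleColouring K₁ K₂ (insert x W)
    D₁ = extend₂ D x (just fit₁) nothing
    shared : Fits (forest₂ D₁) y
    shared = colours (forest₂ D) , n<1+n _ , fresh-colour-mates (ranking D) (forest₂ D) x y
    finish : Fits (forest₁ D₁) y ⊎ Fails (forest₁ D₁) y → Cheap D (insert y (insert x W))
    finish (inj₁ fit) = extend₂ D₁ y (just fit) (just shared) , ≤-reflexive (+-suc _ _)
    finish (inj₂ fails₁) = ⊥-elim (<⇒≱ crowded (≤-trans
      (2*sum≤ {colours (forest₁ D)}
              (≤-trans (fails⇒2*colours≤degree (forest₁ D₁) fails₁) (degree-insert-≤ K₁ Wx y))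
              (fails⇒2*colours≤degree (forest₂ D) fails₂))
      (≤-reflexive (cong suc (degree-sum Wy)))))

  crossed-failures : {x y : Fin N} → W x ≡ false → suc (count W) < 2 * total D →
                     degreeIn K₁ W y ≤ suc (degreeIn K₁ W x) →
                     Fails (forest₂ D) x → Fails (forest₁ D) y → ⊥
  crossed-failures Wx crowded balanced fails₂ fails₁ = <⇒≱ crowded (≤-trans
    (2*sum≤ {colours (forest₁ D)}
            (≤-trans (fails⇒2*colours≤degree (forest₁ D) fails₁) balanced)
            (fails⇒2*colours≤degree (forest₂ D) fails₂))
    (≤-reflexive (cong suc (degree-sum Wx))))

-- If 2(a₁ + a₂) > |W| + 1, no vertex outside W fails in both colourings, and the
-- degree balance rules out u and v failing in different ones.
extend-pair : {K₁ K₂ : Graph N} → Complementary K₁ K₂ → {W : Fin N → Bool} (D : DoubleColouring K₁ K₂ W)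
              {u v : Fin N} → W u ≡ false → W v ≡ false → ¬ u ≡ v → suc (count W) < 2 * total D →
              Balanced K₁ W u v → Cheap≗ D (insert v (insert u W))
extend-pair {K₁ = K₁} {K₂} complementary {W} D {u} {v} Wu Wv u≢v crowded (u≲v , v≲u) =
  cases (fits-or-fails (forest₁ D) u) (fits-or-fails (forest₂ D) u)
        (fits-or-fails (forest₁ D) v) (fits-or-fails (forest₂ D) v)
  where
  v≢u : ¬ v ≡ u
  v≢u = u≢v ∘ sym
  crowded-swap : suc (count W) < 2 * total (swap D)
  crowded-swap = subst (λ t → suc (count W) < 2 * t) (+-comm (colours (forest₁ D)) _) crowded
  in-order : Cheap D (insert v (insert u W)) → Cheap≗ D (insert v (insert u W))
  in-order cheap = _ , (λ _ → refl) , cheap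
  reversed : Cheap D (insert u (insert v W)) → Cheap≗ D (insert v (insert u W))
  reversed cheap = _ , insert-comm {W = W} u v , cheap
  both-fail : ∀ {x} → W x ≡ false → Fails (forest₁ D) x → Fails (forest₂ D) x → ⊥
  both-fail {x} Wx fails₁ fails₂ =
    <⇒≱ crowded (m≤n⇒m≤1+n (fails-both complementary D {x} Wx fails₁ fails₂))
  cases : Fits (forest₁ D) u ⊎ Fails (forest₁ D) u → Fits (forest₂ D) u ⊎ Fails (forest₂ D) u →
          Fits (forest₁ D) v ⊎ Fails (forest₁ D) v → Fits (forest₂ D) v ⊎ Fails (forest₂ D) v →
          Cheap≗ D (insert v (insert u W))
  cases (inj₂ fails₁) (inj₂ fails₂) _ _ = ⊥-elim (both-fail Wu fails₁ fails₂)
  cases _ _ (inj₂ fails₁) (inj₂ fails₂) = ⊥-elim (both-fail Wv fails₁ fails₂)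
  cases (inj₁ fit₁) (inj₁ fit₂) _ _ =
    in-order (extend-fitting complementary D Wu v≢u Wv crowded fit₁ fit₂)
  cases _ _ (inj₁ fit₁) (inj₁ fit₂) =
    reversed (extend-fitting complementary D Wv u≢v Wu crowded fit₁ fit₂)
  cases (inj₁ fit₁) (inj₂ _) (inj₁ _) (inj₂ fails₂) =
    in-order (share-fresh complementary D Wu v≢u Wv crowded fit₁ fails₂)
  cases (inj₂ _) (inj₁ fit₂) (inj₂ fails₁) (inj₁ _) =
    in-order (unswap D (share-fresh (complementary-sym {K₁ = K₁} {K₂} complementary) (swap D)
                                    Wu v≢u Wv crowded-swap fit₂ fails₁))
  cases (inj₁ _) (inj₂ fails₂) (inj₂ fails₁) (inj₁ _) =
    ⊥-elim (crossed-failures complementary D Wu crowded v≲u fails₂ fails₁)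
  cases (inj₂ fails₁) (inj₁ _) (inj₁ _) (inj₂ fails₂) =
    ⊥-elim (crossed-failures complementary D Wv crowded u≲v fails₂ fails₁)

-- The vertex set of the colouring is only pointwise equal to S, for lack of
-- function extensionality.
record Economical (K₁ K₂ : Graph N) (S : Fin N → Bool) (k : ℕ) : Set where
  field
    placed     : Fin N → Bool
    placed≗S   : placed ≗ S
    colouring  : DoubleColouring K₁ K₂ placed
    budget     : 2 * total colouring ≤ k + 3
open Economical

emptyColouring : {K₁ K₂ : Graph N} → DoubleColouring K₁ K₂ (λ _ → false)
emptyColouring = record
  { ranking = record { rank = λ _ → 0 ; next = 0 ; rank<next = λ () ; rank-injective = λ () }
  ; forest₁ = uncoloured
  ; forest₂ = uncoloured
  }
  where
  uncoloured : {K : Graph _} → ForestColouring K (λ _ → false) (λ _ → 0)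
  uncoloured = record { colour = λ _ → 0 ; colours = 0 ; colour<colours = λ () ; no-two-lower-mates = λ () }

economical-empty : {K₁ K₂ : Graph N} {S : Fin N → Bool} → count S ≡ 0 → Economical K₁ K₂ S 0
economical-empty {S = S} none = record
  { placed = λ _ → false
  ; placed≗S = sym ∘ count≡0⇒empty none
  ; colouring = emptyColouring
  ; budget = z≤n
  }

economical-single : {K₁ K₂ : Graph N} {S : Fin N → Bool} → count S ≡ 1 → Economical K₁ K₂ S 1
economical-single {S = S} one with count>0⇒∃ {p = S} (≤-reflexive (sym one))
... | x , Sx = record
  { placed = insert x (λ _ → false)
  ; placed≗S = singleton
  ; colouring = extend₂ emptyColouring x nothing nothing
  ; budget = ≤-refl
  }
  where
  rest-empty : remove x S ≗ λ _ → false
  rest-empty = count≡0⇒empty (suc-injective (trans (sym (count-remove {S = S} Sx)) one))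
  singleton : insert x (λ _ → false) ≗ S
  singleton y = trans (cong (_∨ (y == x)) (sym (rest-empty y))) (insert-remove {S = S} Sx y)

two-fresh-bound : ∀ a₁ a₂ {k} → 2 * (a₁ + a₂) ≤ suc k → 2 * (suc a₁ + suc a₂) ≤ suc (suc k) + 3
two-fresh-bound a₁ a₂ {k} small = begin
  2 * (suc a₁ + suc a₂)   ≡⟨ cong (2 *_) (cong suc (+-suc a₁ a₂)) ⟩
  2 * (2 + (a₁ + a₂))     ≡⟨ *-distribˡ-+ 2 2 (a₁ + a₂) ⟩
  4 + 2 * (a₁ + a₂)       ≤⟨ +-monoʳ-≤ 4 small ⟩
  4 + suc k               ≡⟨ +-comm 4 (suc k) ⟩
  suc k + 4               ≡⟨ +-suc (suc k) 3 ⟩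
  suc (suc k) + 3         ∎
  where open ≤-Reasoning

one-more-bound : ∀ {t′ t k} → t′ ≤ suc t → 2 * t ≤ k + 3 → 2 * t′ ≤ suc (suc k) + 3
one-more-bound {t′} {t} {k} cheap bound = begin
  2 * t′        ≤⟨ *-monoʳ-≤ 2 cheap ⟩
  2 * suc t     ≡⟨ *-suc 2 t ⟩
  2 + 2 * t     ≤⟨ +-monoʳ-≤ 2 bound ⟩
  2 + (k + 3)   ∎
  where open ≤-Reasoning

module _ {K₁ K₂ : Graph N} (complementary : Complementary K₁ K₂)
         {S : Fin N → Bool} {u v : Fin N} {k : ℕ} (Su : S u ≡ true) (Sv : S v ≡ true) (u≢v : ¬ u ≡ v)
         (rest-size : count (remove u (remove v S)) ≡ k)
         (balanced : Balanced K₁ S u v) (E : Economical K₁ K₂ (remove u (remove v S)) k) where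

  private
    W : Fin N → Bool
    W = placed E
    D : DoubleColouring K₁ K₂ W
    D = colouring E
    Su′ : remove v S u ≡ true
    Su′ = remove-other {S = S} Su u≢v
    Wu : W u ≡ false
    Wu = trans (placed≗S E u) (remove-self (remove v S) u)
    Wv : W v ≡ false
    Wv = trans (placed≗S E v) (cong (_∧ not (v == u)) (remove-self S v))
    restored : insert v (insert u W) ≗ S
    restored y = begin
      (W y ∨ (y == u)) ∨ (y == v)
        ≡⟨ cong (λ b → (b ∨ (y == u)) ∨ (y == v)) (placed≗S E y) ⟩
      (remove u (remove v S) y ∨ (y == u)) ∨ (y == v)
        ≡⟨ cong (_∨ (y == v)) (insert-remove {S = remove v S} Su′ y) ⟩
      remove v S y ∨ (y == v)
        ≡⟨ insert-remove {S = S} Sv y ⟩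
      S y
        ∎
      where open ≡-Reasoning
    count-W : count W ≡ k
    count-W = trans (count-cong (placed≗S E)) rest-size
    balanced-W : Balanced K₁ W u v
    balanced-W = balanced-cong K₁ (sym ∘ placed≗S E) (balanced-remove-pair K₁ Su Sv u≢v balanced)
    shared : ∀ {K} (F : ForestColouring K W (rank (ranking D))) → Fits (extend (ranking D) F u nothing) v
    shared F = colours F , n<1+n _ , fresh-colour-mates (ranking D) F u v

  add-pair : Economical K₁ K₂ S (suc (suc k))
  add-pair with 2 * total D ≤? suc k
  ... | yes small = record
    { placed = insert v (insert u W)
    ; placed≗S = restored
    ; colouring = extend₂ (extend₂ D u nothing nothing) v
                          (just (shared (forest₁ D))) (just (shared (forest₂ D)))
    ; budget = two-fresh-bound (colours (forest₁ D)) (colours (forest₂ D)) small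
    }
  ... | no not-small
    with extend-pair complementary D Wu Wv u≢v
                     (subst (λ c → suc c < 2 * total D) (sym count-W) (≰⇒> not-small)) balanced-W
  ... | W″ , W″≗ , D″ , cheap = record
    { placed = W″
    ; placed≗S = λ y → trans (W″≗ y) (restored y)
    ; colouring = D″
    ; budget = one-more-bound cheap (budget E)
    }

economical : {K₁ K₂ : Graph N} → Complementary K₁ K₂ → ∀ k (S : Fin N → Bool) → count S ≡ k →
             Economical K₁ K₂ S k
economical complementary zero S none = economical-empty none
economical complementary (suc zero) S one = economical-single one
economical {K₁ = K₁} complementary (suc (suc k)) S size
  with balanced-pair K₁ S (≤-trans (s≤s (s≤s z≤n)) (≤-reflexive (sym size)))
... | u , v , Su , Sv , u≢v , balanced =
  add-pair complementary Su Sv u≢v rest-size balanced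
    (economical complementary k (remove u (remove v S)) rest-size)
  where
  rest-size : count (remove u (remove v S)) ≡ k
  rest-size = suc-injective (suc-injective (begin
    suc (suc (count (remove u (remove v S))))
      ≡⟨ cong suc (count-remove {S = remove v S} (remove-other {S = S} Su u≢v)) ⟨
    suc (count (remove v S))                  ≡⟨ count-remove {S = S} Sv ⟨
    count S                                   ≡⟨ size ⟩
    suc (suc k)                               ∎))
    where open ≡-Reasoning

-- G-free colourings and the G-chromatic number

length-filter-tabulate : {A : Set} {P : A → Set} (P? : ∀ x → Dec (P x)) (g : Fin N → A) →
                         length (filter P? (tabulate g)) ≡ count (λ i → does (P? (g i)))
length-filter-tabulate {zero} P? g = refl
length-filter-tabulate {suc N} P? g with does (P? (g zero))
... | true  = cong suc (length-filter-tabulate P? (g ∘ suc))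
... | false = length-filter-tabulate P? (g ∘ suc)

degree≡count : (G : Graph N) (v : Fin N) → degree G v ≡ count (adj G v)
degree≡count G v =
  trans (length-filter-tabulate (λ j → adj G v j ≟ᵇ true) (λ j → j)) (count-cong (does-≟true ∘ adj G v))
  where
  does-≟true : ∀ b → does (b ≟ᵇ true) ≡ b
  does-≟true true  = refl
  does-≟true false = refl

two-neighbours : (G : Graph N) → TwoRegular G → (v : Fin N) →
                 ∃ λ x → ∃ λ y → ¬ x ≡ y × adj G v x ≡ true × adj G v y ≡ true
two-neighbours G (_ , two-regular) v =
  count≥2⇒∃₂ (≤-reflexive (trans (sym (two-regular v)) (degree≡count G v)))

highest : {m : ℕ} (r : Fin (suc m) → ℕ) → ∃ λ top → ∀ w → r w ≤ r top
highest r = argmax r zero (allFin _) , λ w → lookup (f[xs]≤f[argmax] {f = r} zero (allFin _)) (∈-allFin w)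

forest⇒GFree : {m : ℕ} (G : Graph m) → TwoRegular G → {K : Graph N} {W : Fin N → Bool}
               (R : Ranking W) (F : ForestColouring K W (rank R)) (everywhere : ∀ x → W x ≡ true) →
               GFreeColoring G K (colours F) (λ x → fromℕ< (colour<colours F (everywhere x)))
forest⇒GFree {m = zero} G (() , _)
forest⇒GFree {m = suc m} G two-regular {K} R F everywhere c (f , f-injective , in-class , edges)
  with highest (rank R ∘ f)
... | top , top-highest with two-neighbours G two-regular top
... | w₁ , w₂ , w₁≢w₂ , top-w₁ , top-w₂ =
  no-two-lower-mates F (everywhere _) (everywhere _) (everywhere _) (w₁≢w₂ ∘ f-injective)
    (edges top w₁ top-w₁) (edges top w₂ top-w₂) (same-class w₁) (same-class w₂)
    (lower w₁ top-w₁) (lower w₂ top-w₂)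
  where
  in-c : ∀ w → colour F (f w) ≡ toℕ c
  in-c w = trans (sym (toℕ-fromℕ< _)) (cong toℕ (in-class w))
  same-class : ∀ w → colour F (f w) ≡ colour F (f top)
  same-class w = trans (in-c w) (sym (in-c top))
  lower : ∀ w → adj G top w ≡ true → rank R (f w) < rank R (f top)
  lower w top-w = ≤∧≢⇒< (top-highest w) λ same-rank →
    adj-irrefl K (rank-injective R (everywhere _) (everywhere _) (sym same-rank)) (edges top w top-w)

forest⇒colourable : {m : ℕ} (G : Graph m) → TwoRegular G → {K : Graph N} {W : Fin N → Bool}
                    (R : Ranking W) (F : ForestColouring K W (rank R)) → (∀ x → W x ≡ true) →
                    GFreeColorable G K (colours F)
forest⇒colourable G two-regular R F everywhere =
  (λ x → fromℕ< (colour<colours F (everywhere x))) , forest⇒GFree G two-regular R F everywhere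

any-function? : ∀ a {b} {P : (Fin a → Fin b) → Set} → (∀ {f g} → f ≗ g → P f → P g) →
                (∀ f → Dec (P f)) → Dec (∃ P)
any-function? zero respects P? = map′ (λ p → _ , p) (λ (f , p) → respects (λ ()) p) (P? λ ())
any-function? (suc a) respects P? =
  map′ (λ (x , g , p) → x ∷ g , p)
       (λ (f , p) → head f , tail f , respects (λ { zero → refl ; (suc i) → refl }) p)
       (any? λ x → any-function? a (λ f≗g → respects λ { zero → refl ; (suc i) → f≗g i })
                                   (P? ∘ (x ∷_)))

injective? : {a b : ℕ} (f : Fin a → Fin b) → Dec (Injective _≡_ _≡_ f)
injective? f =
  map′ (λ h {x} {y} → h x y) (λ h x y → h) (all? λ x → all? λ y → (f x ≟ f y) →-dec (x ≟ y))

copy? : {m n : ℕ} (G : Graph m) (K : Graph n) {P : Fin n → Set} → (∀ x → Dec (P x)) →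
        Dec (CopyIn G K P)
copy? {m} G K {P} P? = any-function? m respects λ f →
  injective? f ×-dec all? (P? ∘ f) ×-dec
  all? λ u → all? λ v → (adj G u v ≟ᵇ true) →-dec (adj K (f u) (f v) ≟ᵇ true)
  where
  respects : ∀ {f g} → f ≗ g →
             Injective _≡_ _≡_ f × (∀ v → P (f v)) × (∀ u v → adj G u v ≡ true → adj K (f u) (f v) ≡ true) →
             Injective _≡_ _≡_ g × (∀ v → P (g v)) × (∀ u v → adj G u v ≡ true → adj K (g u) (g v) ≡ true)
  respects f≗g (f-injective , in-P , edges) =
    (λ {x} {y} gx≡gy → f-injective (trans (f≗g x) (trans gx≡gy (sym (f≗g y))))) ,
    (λ v → subst P (f≗g v) (in-P v)) ,
    (λ u v uv → subst₂ (λ x y → adj K x y ≡ true) (f≗g u) (f≗g v) (edges u v uv))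

colourable? : {m n : ℕ} (G : Graph m) (H : Graph n) (k : ℕ) → Dec (GFreeColorable G H k)
colourable? {n = n} G H k = any-function? n respects λ π → all? λ c → ¬? (copy? G H (λ x → π x ≟ c))
  where
  respects : ∀ {π σ} → π ≗ σ → GFreeColoring G H k π → GFreeColoring G H k σ
  respects π≗σ free c (f , f-injective , in-c , edges) =
    free c (f , f-injective , (λ v → trans (π≗σ (f v)) (in-c v)) , edges)

least : (P : ℕ → Set) → (∀ n → Dec (P n)) → ∀ {k} → P k → Σ ℕ λ j → P j × (∀ i → P i → j ≤ i)
least P P? {k} Pk with least-upto k
  where
  least-upto : ∀ k → (∀ i → i ≤ k → ¬ P i) ⊎ Σ ℕ λ j → P j × (∀ i → P i → j ≤ i)
  least-upto zero with P? zero
  ... | yes P0 = inj₂ (zero , P0 , λ _ _ → z≤n)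
  ... | no ¬P0 = inj₁ λ { zero _ → ¬P0 }
  least-upto (suc k) with least-upto k | P? (suc k)
  ... | inj₂ found | _ = inj₂ found
  ... | inj₁ none | yes Pk = inj₂ (suc k , Pk , λ i Pi → ≰⇒> λ i≤k → none i i≤k Pi)
  ... | inj₁ none | no ¬Pk = inj₁ λ i i≤1+k →
    [ (λ i<1+k → none i (≤-pred i<1+k)) , (λ { refl → ¬Pk }) ]′ (m≤n⇒m<n∨m≡n i≤1+k)
... | inj₁ none = ⊥-elim (none k ≤-refl Pk)
... | inj₂ found = found

χ-exists : {m n : ℕ} (G : Graph m) (H : Graph n) {k : ℕ} → GFreeColorable G H k →
           Σ ℕ λ χ → IsChiG G H χ × χ ≤ k
χ-exists G H colourable with least (GFreeColorable G H) (colourable? G H) colourable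
... | χ , χ-colourable , minimal = χ , (χ-colourable , minimal) , minimal _ colourable

-- The Nordhaus–Gaddum bound and its sharpness

≤⌊/2⌋ : ∀ {s b} → 2 * s ≤ b → s ≤ ⌊ b /2⌋
≤⌊/2⌋ {s} {b} 2s≤b =
  subst (_≤ ⌊ b /2⌋) (sym (n≡⌊n+n/2⌋ s)) (⌊n/2⌋-mono (subst (_≤ b) (cong (s +_) (+-identityʳ s)) 2s≤b))

⌊n+3/2⌋≡⌈n/2⌉+1 : ∀ n → ⌊ n + 3 /2⌋ ≡ ⌈ n /2⌉ + 1
⌊n+3/2⌋≡⌈n/2⌉+1 n rewrite +-comm n 3 | +-comm ⌈ n /2⌉ 1 = refl

chromatic-sum-bound : {m n : ℕ} (G : Graph m) → TwoRegular G → (H : Graph n) →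
                      Economical H (complement H) (λ _ → true) n →
                      Σ ℕ λ k₁ → Σ ℕ λ k₂ →
                        IsChiG G H k₁ × IsChiG G (complement H) k₂ × (k₁ + k₂ ≤ ⌈ n /2⌉ + 1)
chromatic-sum-bound {n = n} G two-regular H E
  with χ-exists G H (forest⇒colourable G two-regular R (forest₁ D) (placed≗S E))
     | χ-exists G (complement H) (forest⇒colourable G two-regular R (forest₂ D) (placed≗S E))
  where
  D = colouring E
  R = ranking D
... | k₁ , χ₁ , k₁≤ | k₂ , χ₂ , k₂≤ = k₁ , k₂ , χ₁ , χ₂ ,
  ≤-trans (+-mono-≤ k₁≤ k₂≤) (≤-trans (≤⌊/2⌋ (budget E)) (≤-reflexive (⌊n+3/2⌋≡⌈n/2⌉+1 n)))

edgeless : (n : ℕ) → Graph n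
edgeless n = record { adj = λ _ _ → false ; adj-sym = λ _ _ → refl ; adj-irr = λ _ → refl }

triangle : Graph 3
triangle = complement (edgeless 3)

triangle-two-regular : TwoRegular triangle
triangle-two-regular = s≤s z≤n , λ { zero → refl ; (suc zero) → refl ; (suc (suc zero)) → refl }

χ-triangle-one-vertex : (K : Graph 1) → IsChiG triangle K 1
χ-triangle-one-vertex K = ((λ _ → zero) , no-copy) , at-least-one
  where
  no-copy : GFreeColoring triangle K 1 (λ _ → zero)
  no-copy _ (f , f-injective , _) with pigeonhole (s≤s (s≤s z≤n)) f
  ... | i , j , i<j , fi≡fj = <-irrefl (cong toℕ (f-injective fi≡fj)) i<j
  at-least-one : ∀ k → GFreeColorable triangle K k → 1 ≤ k
  at-least-one zero (π , _) with π zero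
  ... | ()
  at-least-one (suc k) _ = s≤s z≤n

theorem7 : ((m : ℕ) (G : Graph m) → TwoRegular G → (n : ℕ) (H : Graph n) →
             Σ ℕ λ k₁ → Σ ℕ λ k₂ →
               IsChiG G H k₁ × IsChiG G (complement H) k₂ × (k₁ + k₂ ≤ ⌈ n /2⌉ + 1))
           × (Σ ℕ λ m → Σ (Graph m) λ G → Σ ℕ λ n → Σ (Graph n) λ H →
               TwoRegular G × (Σ ℕ λ k₁ → Σ ℕ λ k₂ →
                 IsChiG G H k₁ × IsChiG G (complement H) k₂ × (k₁ + k₂ ≡ ⌈ n /2⌉ + 1)))
theorem7 =
  (λ m G two-regular n H →
     chromatic-sum-bound G two-regular H (economical (complement-complementary H) n (λ _ → true) count-all)) ,
  (3 , triangle , 1 , edgeless 1 , triangle-two-regular ,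
   1 , 1 , χ-triangle-one-vertex (edgeless 1) , χ-triangle-one-vertex (complement (edgeless 1)) , refl)
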